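{- For every matroid $\mathcal M=(E,\mathcal I)$ with $E\ne\emptyset$ and no loops, $$\frac{1}{\min_{e\in E}\ell^*(e)}=\max_{\emptyset\neq A\subseteq E}\frac{|A|}{\mathrm{rk}(A)}.$$
   Context: $\mathrm{rk}(A)=\max\{|A'|:A'\in\mathcal I,A'\subseteq A\}$. For a matroid $\mathcal N$ on ground set $F$, $\Phi_{\mathcal N}=\min\{|A|/(\mathrm{rk}(F)-\mathrm{rk}(F\setminus A)): A\subseteq F,\mathrm{rk}(F\setminus A)<\mathrm{rk}(F)\}$. The restriction $\mathcal M|A$ is the matroid on $A$ with independent sets $\{X\in\mathcal I: X\subseteq A\}$. Ideal relative loads $\ell^*$: choose $A_0\subseteq E$ attaining $\Phi_{\mathcal M}$, set $\ell^*(e)=1/\Phi_{\mathcal M}$ for all $e\in A_0$, and recurse on $\mathcal M|(E\setminus A_0)$ until every element is assigned (the result does not depend on the choices). -}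

module Defs where

open import Data.Nat using (ℕ; zero; suc; _<_; _∸_; _⊔_)
open import Data.Bool using (Bool; true; false; _∧_)
open import Data.Vec using (Vec; []; _∷_)
open import Data.List using (List; []; _∷_; map; _++_; filter; foldr)
open import Data.Fin using (Fin)
open import Data.Fin.Subset using (Subset; ⊥; ⁅_⁆; _∪_; _─_; ∣_∣; _⊆_; _∈_; _∉_; Empty; Nonempty)
open import Data.Product using (∃; _×_)
open import Data.Rational using (ℚ; 0ℚ; _/_; _≤_)
open import Data.Integer using (+_)
open import Relation.Binary.PropositionalEquality using (_≡_)
open import Relation.Nullary.Decidable using (T?)

record Matroid (n : ℕ) : Set where
  field
    indep       : Subset n → Bool
    indep-empty : indep ⊥ ≡ true
    indep-down  : ∀ {X Y} → X ⊆ Y → indep Y ≡ true → indep X ≡ true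
    indep-exch  : ∀ {X Y} → indep X ≡ true → indep Y ≡ true → ∣ X ∣ < ∣ Y ∣ →
                  ∃ λ y → y ∈ Y × y ∉ X × indep (X ∪ ⁅ y ⁆) ≡ true
open Matroid public

allSubsets : ∀ n → List (Subset n)
allSubsets zero = [] ∷ []
allSubsets (suc n) = map (true ∷_) (allSubsets n) ++ map (false ∷_) (allSubsets n)

_⊆ᵇ_ : ∀ {n} → Subset n → Subset n → Bool
[] ⊆ᵇ [] = true
(true ∷ xs) ⊆ᵇ (false ∷ ys) = false
(_ ∷ xs) ⊆ᵇ (_ ∷ ys) = xs ⊆ᵇ ys

rk : ∀ {n} → Matroid n → Subset n → ℕ
rk {n} M A = foldr _⊔_ 0
  (map ∣_∣ (filter (λ X → T? (indep M X ∧ (X ⊆ᵇ A))) (allSubsets n)))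

Loopless : ∀ {n} → Matroid n → Set
Loopless {n} M = ∀ (e : Fin n) → indep M ⁅ e ⁆ ≡ true

-- the rational p / q  (convention p / 0 = 0; only used with q > 0)
frac : ℕ → ℕ → ℚ
frac p zero = 0ℚ
frac p (suc q) = (+ p) / suc q

-- A0 attains Φ of the restriction M|S, i.e.
-- Φ_{M|S} = min { |A| / (rk S − rk(S∖A)) : A ⊆ S, rk(S∖A) < rk S }.
-- (The rank function of M|S is rk restricted to subsets of S.)
AttainsΦ : ∀ {n} → Matroid n → Subset n → Subset n → Set
AttainsΦ M S A0 =
  A0 ⊆ S × rk M (S ─ A0) < rk M S ×
  (∀ A → A ⊆ S → rk M (S ─ A) < rk M S →
     frac (∣ A0 ∣) (rk M S ∸ rk M (S ─ A0)) ≤ frac (∣ A ∣) (rk M S ∸ rk M (S ─ A)))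

-- IdealLoadOn M ℓ S : ℓ restricted to S arises from the recursive
-- construction of the ideal relative loads of M|S (for some sequence of choices).
data IdealLoadOn {n} (M : Matroid n) (ℓ : Fin n → ℚ) : Subset n → Set where
  done : ∀ {S} → Empty S → IdealLoadOn M ℓ S
  step : ∀ {S A0} → AttainsΦ M S A0 →
         (∀ e → e ∈ A0 → ℓ e ≡ frac (rk M S ∸ rk M (S ─ A0)) (∣ A0 ∣)) →   -- ℓ e = 1/Φ
         IdealLoadOn M ℓ (S ─ A0) →
         IdealLoadOn M ℓ S

IsIdealLoad : ∀ {n} → Matroid n → (Fin n → ℚ) → Set
IsIdealLoad M ℓ = IdealLoadOn M ℓ Data.Fin.Subset.⊤

-- Let e₀ carry the minimum load λ, assigned in the layer A0 removed from S, so that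
-- λ = d / a with d = rk S − rk (S ∖ A0) and a = |A0|.  Since every load is at least λ,
-- induction along the construction gives |A| λ ≤ rk A for every A: within a layer, the
-- minimality of Φ bounds |A ∩ A0| λ by the rank that A ∩ A0 adds to S ∖ A0, and by
-- submodularity these gains sum to at most rk A.  Choosing S itself in the minimum defining
-- Φ gives a/d ≤ |S|/rk S, hence equality, so S is a densest set and 1/λ = |S|/rk S.
module Submission where

module SubsetProperties where

  open import Data.Nat using (ℕ; suc; _+_; _<_; z≤n)
  open import Data.Nat.Properties using (+-suc; ≤-<-trans)
  open import Data.Bool using (T)
  open import Data.Unit using (tt)
  open import Data.Vec using ([]; _∷_; here; there)
  open import Data.List using (map)
  open import Data.List.Membership.Propositional using () renaming (_∈_ to _∈ₗ_)
  open import Data.List.Membership.Propositional.Properties using (∈-++⁺ˡ; ∈-++⁺ʳ; ∈-map⁺)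
  open import Data.List.Relation.Unary.Any using () renaming (here to hereₗ)
  open import Data.Fin using (zero; suc)
  open import Data.Fin.Subset
  open import Data.Fin.Subset.Properties using (p─q⊆p; x∈p∧x∉q⇒x∈p─q; x∈p∪q⁻; x∈⁅y⁆⇒x≡y;
      ∪-identityʳ; drop-∷-⊆; Empty-unique; ∣⊥∣≡0; x∈p⇒∣p-x∣<∣p∣)
  open import Data.Product using (_×_; _,_)
  open import Data.Sum using (inj₁; inj₂)
  open import Function using (_∘_)
  open import Relation.Binary.PropositionalEquality using (_≡_; refl; sym; cong; trans; subst)
  open import Defs using (allSubsets; _⊆ᵇ_)

  private
    variable
      n : ℕ

  allSubsets-complete : ∀ n (p : Subset n) → p ∈ₗ allSubsets n
  allSubsets-complete _ [] = hereₗ refl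
  allSubsets-complete (suc n) (inside ∷ p) = ∈-++⁺ˡ (∈-map⁺ (inside ∷_) (allSubsets-complete n p))
  allSubsets-complete (suc n) (outside ∷ p) =
    ∈-++⁺ʳ (map (inside ∷_) (allSubsets n)) (∈-map⁺ (outside ∷_) (allSubsets-complete n p))

  ⊆ᵇ-sound : ∀ (p q : Subset n) → T (p ⊆ᵇ q) → p ⊆ q
  ⊆ᵇ-sound (inside ∷ p) (inside ∷ q) _ here = here
  ⊆ᵇ-sound (inside ∷ p) (inside ∷ q) t (there x∈p) = there (⊆ᵇ-sound p q t x∈p)
  ⊆ᵇ-sound (outside ∷ p) (inside ∷ q) t (there x∈p) = there (⊆ᵇ-sound p q t x∈p)
  ⊆ᵇ-sound (outside ∷ p) (outside ∷ q) t (there x∈p) = there (⊆ᵇ-sound p q t x∈p)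

  ⊆ᵇ-complete : ∀ (p q : Subset n) → p ⊆ q → T (p ⊆ᵇ q)
  ⊆ᵇ-complete [] [] _ = tt
  ⊆ᵇ-complete (inside ∷ p) (inside ∷ q) p⊆q = ⊆ᵇ-complete p q (drop-∷-⊆ p⊆q)
  ⊆ᵇ-complete (outside ∷ p) (inside ∷ q) p⊆q = ⊆ᵇ-complete p q (drop-∷-⊆ p⊆q)
  ⊆ᵇ-complete (outside ∷ p) (outside ∷ q) p⊆q = ⊆ᵇ-complete p q (drop-∷-⊆ p⊆q)
  ⊆ᵇ-complete (inside ∷ p) (outside ∷ q) p⊆q with p⊆q here
  ... | ()

  x∈p─q⁻ : ∀ (p q : Subset n) {x} → x ∈ p ─ q → x ∈ p × x ∉ q
  x∈p─q⁻ p q x∈p─q = p─q⊆p p q x∈p─q , x∉q p q x∈p─q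
    where
    x∉q : ∀ {n} (p q : Subset n) {x} → x ∈ p ─ q → x ∉ q
    x∉q (inside ∷ p) (outside ∷ q) here ()
    x∉q (_ ∷ p) (_ ∷ q) (there x∈p─q) (there x∈q) = x∉q p q x∈p─q x∈q

  p─p-Empty : ∀ (p : Subset n) → Empty (p ─ p)
  p─p-Empty p (x , x∈p─p) with x∈p─q⁻ p p x∈p─p
  ... | x∈p , x∉p = x∉p x∈p

  p⊆q⇒p─r⊆q─r : ∀ {p q r : Subset n} → p ⊆ q → p ─ r ⊆ q ─ r
  p⊆q⇒p─r⊆q─r {p = p} {r = r} p⊆q x∈p─r with x∈p─q⁻ p r x∈p─r
  ... | x∈p , x∉r = x∈p∧x∉q⇒x∈p─q (p⊆q x∈p) x∉r

  p⊆q⇒r─q⊆r─p : ∀ {p q r : Subset n} → p ⊆ q → r ─ q ⊆ r ─ p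
  p⊆q⇒r─q⊆r─p {q = q} {r} p⊆q x∈r─q with x∈p─q⁻ r q x∈r─q
  ... | x∈r , x∉q = x∈p∧x∉q⇒x∈p─q x∈r (x∉q ∘ p⊆q)

  p∪⁅x⁆⊆q : ∀ {p q : Subset n} {x} → p ⊆ q → x ∈ q → p ∪ ⁅ x ⁆ ⊆ q
  p∪⁅x⁆⊆q {p = p} {q} {x} p⊆q x∈q y∈p∪⁅x⁆ with x∈p∪q⁻ p ⁅ x ⁆ y∈p∪⁅x⁆
  ... | inj₁ y∈p = p⊆q y∈p
  ... | inj₂ y∈⁅x⁆ = subst (_∈ q) (sym (x∈⁅y⁆⇒x≡y x y∈⁅x⁆)) x∈q

  Empty⇒∣p∣≡0 : ∀ {p : Subset n} → Empty p → ∣ p ∣ ≡ 0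
  Empty⇒∣p∣≡0 {n} p-empty = trans (cong ∣_∣ (Empty-unique p-empty)) (∣⊥∣≡0 n)

  x∈p⇒0<∣p∣ : ∀ {p : Subset n} {x} → x ∈ p → 0 < ∣ p ∣
  x∈p⇒0<∣p∣ x∈p = ≤-<-trans z≤n (x∈p⇒∣p-x∣<∣p∣ x∈p)

  ∣p∣≡∣p∩q∣+∣p─q∣ : ∀ (p q : Subset n) → ∣ p ∣ ≡ ∣ p ∩ q ∣ + ∣ p ─ q ∣
  ∣p∣≡∣p∩q∣+∣p─q∣ [] [] = refl
  ∣p∣≡∣p∩q∣+∣p─q∣ (inside ∷ p) (inside ∷ q) = cong suc (∣p∣≡∣p∩q∣+∣p─q∣ p q)
  ∣p∣≡∣p∩q∣+∣p─q∣ (inside ∷ p) (outside ∷ q) = trans (cong suc (∣p∣≡∣p∩q∣+∣p─q∣ p q)) (sym (+-suc _ _))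
  ∣p∣≡∣p∩q∣+∣p─q∣ (outside ∷ p) (inside ∷ q) = ∣p∣≡∣p∩q∣+∣p─q∣ p q
  ∣p∣≡∣p∩q∣+∣p─q∣ (outside ∷ p) (outside ∷ q) = ∣p∣≡∣p∩q∣+∣p─q∣ p q

  ∣p∪q∣+∣p∩q∣≡∣p∣+∣q∣ : ∀ (p q : Subset n) → ∣ p ∪ q ∣ + ∣ p ∩ q ∣ ≡ ∣ p ∣ + ∣ q ∣
  ∣p∪q∣+∣p∩q∣≡∣p∣+∣q∣ [] [] = refl
  ∣p∪q∣+∣p∩q∣≡∣p∣+∣q∣ (inside ∷ p) (inside ∷ q) =
    cong suc (trans (+-suc _ _) (trans (cong suc (∣p∪q∣+∣p∩q∣≡∣p∣+∣q∣ p q)) (sym (+-suc _ _))))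
  ∣p∪q∣+∣p∩q∣≡∣p∣+∣q∣ (inside ∷ p) (outside ∷ q) = cong suc (∣p∪q∣+∣p∩q∣≡∣p∣+∣q∣ p q)
  ∣p∪q∣+∣p∩q∣≡∣p∣+∣q∣ (outside ∷ p) (inside ∷ q) = trans (cong suc (∣p∪q∣+∣p∩q∣≡∣p∣+∣q∣ p q)) (sym (+-suc _ _))
  ∣p∪q∣+∣p∩q∣≡∣p∣+∣q∣ (outside ∷ p) (outside ∷ q) = ∣p∪q∣+∣p∩q∣≡∣p∣+∣q∣ p q

  x∉p⇒∣p∪⁅x⁆∣≡1+∣p∣ : ∀ (p : Subset n) {x} → x ∉ p → ∣ p ∪ ⁅ x ⁆ ∣ ≡ suc ∣ p ∣
  x∉p⇒∣p∪⁅x⁆∣≡1+∣p∣ (inside ∷ p) {zero} x∉p with x∉p here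
  ... | ()
  x∉p⇒∣p∪⁅x⁆∣≡1+∣p∣ (outside ∷ p) {zero} _ = cong (suc ∘ ∣_∣) (∪-identityʳ p)
  x∉p⇒∣p∪⁅x⁆∣≡1+∣p∣ (inside ∷ p) {suc x} x∉p = cong suc (x∉p⇒∣p∪⁅x⁆∣≡1+∣p∣ p (x∉p ∘ there))
  x∉p⇒∣p∪⁅x⁆∣≡1+∣p∣ (outside ∷ p) {suc x} x∉p = x∉p⇒∣p∪⁅x⁆∣≡1+∣p∣ p (x∉p ∘ there)

module RankProperties where

  open import Data.Nat using (ℕ; zero; suc; _+_; _∸_; _⊔_; _≤_; _<_; z<s)
  open import Data.Nat.Properties
  open import Data.Bool using (true; T; _∧_)
  open import Data.Bool.Properties using (T-∧; T-≡)
  open import Data.List using (List; []; _∷_; map; filter; foldr)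
  open import Data.List.Membership.Propositional using () renaming (_∈_ to _∈ₗ_)
  open import Data.List.Membership.Propositional.Properties using (∈-map⁺; ∈-map⁻; ∈-filter⁺; ∈-filter⁻)
  open import Data.List.Relation.Unary.Any using (here; there)
  open import Data.Fin.Subset
  open import Data.Fin.Subset.Properties using (⊥⊆; ∣⊥∣≡0; p⊆q⇒∣p∣≤∣q∣; p⊆p∪q; x∈p∪q⁺; x∈p∪q⁻;
      p∩q⊆p; p∩q⊆q; x∈p∩q⁺; x∈p∩q⁻)
  open import Data.Product using (∃; _×_; _,_)
  open import Data.Sum using (_⊎_; inj₁; inj₂; [_,_]′)
  open import Function using (id; _∘_)
  open import Function.Bundles using (Equivalence)
  open import Relation.Binary.PropositionalEquality using (_≡_; refl; sym; trans; cong; cong₂; subst)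
  open import Relation.Nullary.Decidable using (Dec; T?)
  open import Defs
  open SubsetProperties

  private
    maximum : List ℕ → ℕ
    maximum = foldr _⊔_ 0

    ≤-maximum : ∀ {x} xs → x ∈ₗ xs → x ≤ maximum xs
    ≤-maximum (y ∷ xs) (here refl) = m≤m⊔n y _
    ≤-maximum (y ∷ xs) (there x∈xs) = ≤-trans (≤-maximum xs x∈xs) (m≤n⊔m y _)

    maximum-attained : ∀ xs → maximum xs ≡ 0 ⊎ maximum xs ∈ₗ xs
    maximum-attained [] = inj₁ refl
    maximum-attained (y ∷ xs) with ⊔-sel y (maximum xs)
    ... | inj₁ y⊔m≡y = inj₂ (here y⊔m≡y)
    ... | inj₂ y⊔m≡m with maximum-attained xs
    ...   | inj₁ m≡0 = inj₁ (trans y⊔m≡m m≡0)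
    ...   | inj₂ m∈xs = inj₂ (there (subst (_∈ₗ xs) (sym y⊔m≡m) m∈xs))

  module _ {n} (M : Matroid n) where

    private
      independent-in? : ∀ A X → Dec (T (indep M X ∧ (X ⊆ᵇ A)))
      independent-in? A X = T? (indep M X ∧ (X ⊆ᵇ A))

      independent-in⁺ : ∀ {A X} → indep M X ≡ true → X ⊆ A → T (indep M X ∧ (X ⊆ᵇ A))
      independent-in⁺ {A} {X} X-indep X⊆A =
        Equivalence.from T-∧ (Equivalence.from T-≡ X-indep , ⊆ᵇ-complete X A X⊆A)

      independent-in⁻ : ∀ {A X} → T (indep M X ∧ (X ⊆ᵇ A)) → indep M X ≡ true × X ⊆ A
      independent-in⁻ {A} {X} t with Equivalence.to T-∧ t
      ... | X-indep , X⊆ᵇA = Equivalence.to T-≡ X-indep , ⊆ᵇ-sound X A X⊆ᵇA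

    indep⇒∣X∣≤rk : ∀ {X A} → indep M X ≡ true → X ⊆ A → ∣ X ∣ ≤ rk M A
    indep⇒∣X∣≤rk {X} {A} X-indep X⊆A = ≤-maximum _
      (∈-map⁺ ∣_∣ (∈-filter⁺ (independent-in? A) (allSubsets-complete n X) (independent-in⁺ X-indep X⊆A)))

    rk-basis : ∀ A → ∃ λ X → indep M X ≡ true × X ⊆ A × ∣ X ∣ ≡ rk M A
    rk-basis A with maximum-attained (map ∣_∣ (filter (independent-in? A) (allSubsets n)))
    ... | inj₁ rk≡0 = ⊥ , indep-empty M , ⊥⊆ , trans (∣⊥∣≡0 n) (sym rk≡0)
    ... | inj₂ rk∈ with ∈-map⁻ ∣_∣ rk∈
    ...   | X , X∈ , rk≡∣X∣ with ∈-filter⁻ (independent-in? A) {xs = allSubsets n} X∈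
    ...     | _ , X-indep-in-A with independent-in⁻ X-indep-in-A
    ...       | X-indep , X⊆A = X , X-indep , X⊆A , sym rk≡∣X∣

    rk-mono : ∀ {A B} → A ⊆ B → rk M A ≤ rk M B
    rk-mono {A} A⊆B with rk-basis A
    ... | X , X-indep , X⊆A , ∣X∣≡rk = subst (_≤ _) ∣X∣≡rk (indep⇒∣X∣≤rk X-indep (A⊆B ∘ X⊆A))

    rk-Empty : ∀ {A} → Empty A → rk M A ≡ 0
    rk-Empty {A} A-empty with rk-basis A
    ... | X , _ , X⊆A , ∣X∣≡rk = trans (sym ∣X∣≡rk) (Empty⇒∣p∣≡0 (λ (x , x∈X) → A-empty (x , X⊆A x∈X)))

    rk-augment : ∀ {I Z} → indep M I ≡ true → I ⊆ Z →
                 ∃ λ J → indep M J ≡ true × I ⊆ J × J ⊆ Z × ∣ J ∣ ≡ rk M Z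
    rk-augment {I} {Z} I-indep I⊆Z with rk-basis Z
    ... | K , K-indep , K⊆Z , ∣K∣≡rk =
      augment (rk M Z ∸ ∣ I ∣) I-indep I⊆Z (m∸n+n≡m (indep⇒∣X∣≤rk I-indep I⊆Z))
      where
      augment : ∀ k {I} → indep M I ≡ true → I ⊆ Z → k + ∣ I ∣ ≡ rk M Z →
                ∃ λ J → indep M J ≡ true × I ⊆ J × J ⊆ Z × ∣ J ∣ ≡ rk M Z
      augment zero {I} I-indep I⊆Z ∣I∣≡rk = I , I-indep , id , I⊆Z , ∣I∣≡rk
      augment (suc k) {I} I-indep I⊆Z k+1+∣I∣≡rk
        with indep-exch M I-indep K-indep (subst (∣ I ∣ <_) (trans k+1+∣I∣≡rk (sym ∣K∣≡rk)) (m<n+m ∣ I ∣ z<s))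
      ... | y , y∈K , y∉I , I+y-indep
        with augment k I+y-indep (p∪⁅x⁆⊆q I⊆Z (K⊆Z y∈K))
                     (trans (cong (k +_) (x∉p⇒∣p∪⁅x⁆∣≡1+∣p∣ I y∉I)) (trans (+-suc k _) k+1+∣I∣≡rk))
      ... | J , J-indep , I+y⊆J , J⊆Z , ∣J∣≡rk = J , J-indep , I+y⊆J ∘ p⊆p∪q ⁅ y ⁆ , J⊆Z , ∣J∣≡rk

    rk-submodular : ∀ X Y → rk M (X ∪ Y) + rk M (X ∩ Y) ≤ rk M X + rk M Y
    rk-submodular X Y with rk-basis (X ∩ Y)
    ... | I , I-indep , I⊆X∩Y , ∣I∣≡rk with rk-augment I-indep (p⊆p∪q Y ∘ p∩q⊆p X Y ∘ I⊆X∩Y)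
    ... | J , J-indep , I⊆J , J⊆X∪Y , ∣J∣≡rk = begin
      rk M (X ∪ Y) + rk M (X ∩ Y)                    ≡⟨ cong₂ _+_ (sym ∣J∣≡rk) (sym ∣I∣≡rk) ⟩
      ∣ J ∣ + ∣ I ∣                                  ≤⟨ +-mono-≤ (p⊆q⇒∣p∣≤∣q∣ J⊆JX∪JY) (p⊆q⇒∣p∣≤∣q∣ I⊆JX∩JY) ⟩
      ∣ (J ∩ X) ∪ (J ∩ Y) ∣ + ∣ (J ∩ X) ∩ (J ∩ Y) ∣  ≡⟨ ∣p∪q∣+∣p∩q∣≡∣p∣+∣q∣ (J ∩ X) (J ∩ Y) ⟩
      ∣ J ∩ X ∣ + ∣ J ∩ Y ∣                          ≤⟨ +-mono-≤ (∣J∩A∣≤rk X) (∣J∩A∣≤rk Y) ⟩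
      rk M X + rk M Y                                ∎
      where
      open ≤-Reasoning
      J⊆JX∪JY : J ⊆ (J ∩ X) ∪ (J ∩ Y)
      J⊆JX∪JY x∈J = [ (λ x∈X → x∈p∪q⁺ (inj₁ (x∈p∩q⁺ (x∈J , x∈X))))
                    , (λ x∈Y → x∈p∪q⁺ (inj₂ (x∈p∩q⁺ (x∈J , x∈Y)))) ]′ (x∈p∪q⁻ X Y (J⊆X∪Y x∈J))
      I⊆JX∩JY : I ⊆ (J ∩ X) ∩ (J ∩ Y)
      I⊆JX∩JY x∈I with x∈p∩q⁻ X Y (I⊆X∩Y x∈I)
      ... | x∈X , x∈Y = x∈p∩q⁺ (x∈p∩q⁺ (I⊆J x∈I , x∈X) , x∈p∩q⁺ (I⊆J x∈I , x∈Y))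
      ∣J∩A∣≤rk : ∀ A → ∣ J ∩ A ∣ ≤ rk M A
      ∣J∩A∣≤rk A = indep⇒∣X∣≤rk (indep-down M (p∩q⊆p J A) J-indep) (p∩q⊆q J A)

    rk-submodular-⊆ : ∀ {X Y A B} → X ⊆ A ∪ B → Y ⊆ A ∩ B → rk M X + rk M Y ≤ rk M A + rk M B
    rk-submodular-⊆ {A = A} {B} X⊆A∪B Y⊆A∩B =
      ≤-trans (+-mono-≤ (rk-mono X⊆A∪B) (rk-mono Y⊆A∩B)) (rk-submodular A B)

module FracProperties where

  open import Data.Nat using (zero; suc; _*_; _≤_; _<_; z≤n)
  open import Data.Nat.Properties using (≤-reflexive)
  open import Data.Integer using (+_; +≤+)
  open import Data.Integer.Properties using (pos-*; drop‿+≤+)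
  open import Data.Rational as ℚ using (ℚ; 0ℚ; toℚᵘ)
  open import Data.Rational.Properties using (toℚᵘ-fromℚᵘ; toℚᵘ-mono-≤; toℚᵘ-cancel-≤; ≤-refl; ≤-antisym)
  open import Data.Rational.Unnormalised as ℚᵘ using (mkℚᵘ; *≤*)
  open import Data.Rational.Unnormalised.Properties using (≃-sym; ≤-respˡ-≃; ≤-respʳ-≃)
  open import Relation.Binary.PropositionalEquality using (_≡_; sym; subst₂)
  open import Defs using (frac)

  private
    frac≃mkℚᵘ : ∀ p q → toℚᵘ (frac p (suc q)) ℚᵘ.≃ mkℚᵘ (+ p) q
    frac≃mkℚᵘ p q = toℚᵘ-fromℚᵘ (mkℚᵘ (+ p) q)

  frac-≤-cross⁻ : ∀ {p q r s} → 0 < q → 0 < s → frac p q ℚ.≤ frac r s → p * s ≤ r * q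
  frac-≤-cross⁻ {p} {suc q} {r} {suc s} _ _ p/q≤r/s
    with ≤-respʳ-≃ (frac≃mkℚᵘ r s) (≤-respˡ-≃ (frac≃mkℚᵘ p q) (toℚᵘ-mono-≤ p/q≤r/s))
  ... | *≤* ps≤rq = drop‿+≤+ (subst₂ Data.Integer._≤_ (sym (pos-* p (suc s))) (sym (pos-* r (suc q))) ps≤rq)

  private
    frac-suc-≤⁺ : ∀ p q r s → p * suc s ≤ r * suc q → frac p (suc q) ℚ.≤ frac r (suc s)
    frac-suc-≤⁺ p q r s ps≤rq = toℚᵘ-cancel-≤
      (≤-respʳ-≃ (≃-sym (frac≃mkℚᵘ r s)) (≤-respˡ-≃ (≃-sym (frac≃mkℚᵘ p q))
        (*≤* (subst₂ Data.Integer._≤_ (pos-* p (suc s)) (pos-* r (suc q)) (+≤+ ps≤rq)))))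

  0≤frac : ∀ p q → 0ℚ ℚ.≤ frac p q
  0≤frac p zero = ≤-refl
  0≤frac p (suc q) = frac-suc-≤⁺ 0 0 p q z≤n

  -- No positivity is needed on the left, as frac p 0 = 0.
  frac-≤-cross⁺ : ∀ {p q r s} → 0 < s → p * s ≤ r * q → frac p q ℚ.≤ frac r s
  frac-≤-cross⁺ {q = zero} {r} {s} _ _ = 0≤frac r s
  frac-≤-cross⁺ {p} {suc q} {r} {suc s} _ ps≤rq = frac-suc-≤⁺ p q r s ps≤rq

  frac-≡-cross : ∀ {p q r s} → 0 < q → 0 < s → p * s ≡ r * q → frac p q ≡ frac r s
  frac-≡-cross 0<q 0<s ps≡rq =
    ≤-antisym (frac-≤-cross⁺ 0<s (≤-reflexive ps≡rq)) (frac-≤-cross⁺ 0<q (≤-reflexive (sym ps≡rq)))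

module IdealLoadProperties where

  open import Data.Nat using (ℕ; suc; _+_; _*_; _∸_; _≤_; _<_; z≤n; >-nonZero)
  open import Data.Nat.Properties
  open import Data.Fin using (Fin; zero)
  open import Data.Fin.Subset
  open import Data.Fin.Subset.Properties using (∈⊤; p─q⊆p; x∈p∧x∉q⇒x∈p─q; x∈p∪q⁺; x∈p∩q⁺; ∩-comm;
      _∈?_; nonempty?; Empty-unique; p─⊥≡p)
  open import Data.List using (List; allFin)
  open import Data.List.Extrema using (argmin; f[argmin]≤f[xs])
  open import Data.List.Membership.Propositional.Properties using (∈-allFin)
  open import Data.List.Relation.Unary.All using (lookup)
  open import Data.Product using (∃; ∃₂; _×_; _,_)
  open import Data.Sum using (inj₁; inj₂)
  open import Data.Empty using (⊥-elim)
  open import Data.Rational as ℚ using (ℚ)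
  import Data.Rational.Properties as ℚ
  open import Function using (id; _∘_)
  open import Relation.Binary.Bundles using (TotalOrder)
  open import Relation.Binary.PropositionalEquality using (_≡_; refl; sym; trans; cong; subst;
      module ≡-Reasoning)
  open import Relation.Nullary using (yes; no)
  open import Defs
  open SubsetProperties
  open RankProperties
  open FracProperties

  minimiser : ∀ {c ℓ₁ ℓ₂} (O : TotalOrder c ℓ₁ ℓ₂) {n} → 0 < n → (f : Fin n → TotalOrder.Carrier O) →
              ∃ λ i → ∀ j → TotalOrder._≤_ O (f i) (f j)
  minimiser O {suc n} _ f =
    argmin O f zero elements , λ j → lookup (f[argmin]≤f[xs] O {f = f} zero elements) (∈-allFin j)
    where
    elements : List (Fin (suc n))
    elements = allFin (suc n)

  m∸o≡[m∸n]+[n∸o] : ∀ {m n o} → o ≤ n → n ≤ m → m ∸ o ≡ (m ∸ n) + (n ∸ o)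
  m∸o≡[m∸n]+[n∸o] {m} {n} {o} o≤n n≤m = begin
    m ∸ o              ≡⟨ cong (_∸ o) (m∸n+n≡m n≤m) ⟨
    (m ∸ n) + n ∸ o    ≡⟨ +-∸-assoc (m ∸ n) o≤n ⟩
    (m ∸ n) + (n ∸ o)  ∎
    where open ≡-Reasoning

  module _ {n} (M : Matroid n) where

    attainsΦ-nonempty : ∀ {S A0} → AttainsΦ M S A0 → Nonempty A0
    attainsΦ-nonempty {S} {A0} (_ , rk[S─A0]<rk[S] , _) with nonempty? A0
    ... | yes A0-nonempty = A0-nonempty
    ... | no A0-empty = ⊥-elim (<-irrefl refl
      (subst (λ T → rk M T < rk M S) (trans (cong (S ─_) (Empty-unique A0-empty)) (p─⊥≡p S)) rk[S─A0]<rk[S]))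

    attainsΦ-cross : ∀ {S A0 C} → AttainsΦ M S A0 → C ⊆ S →
                     ∣ A0 ∣ * (rk M S ∸ rk M (S ─ C)) ≤ ∣ C ∣ * (rk M S ∸ rk M (S ─ A0))
    attainsΦ-cross {S} {A0} {C} (_ , rk[S─A0]<rk[S] , minimal) C⊆S with rk M (S ─ C) <? rk M S
    ... | yes rk[S─C]<rk[S] =
      frac-≤-cross⁻ (m<n⇒0<n∸m rk[S─A0]<rk[S]) (m<n⇒0<n∸m rk[S─C]<rk[S]) (minimal C C⊆S rk[S─C]<rk[S])
    ... | no rk[S─C]≮rk[S] rewrite m≤n⇒m∸n≡0 (≮⇒≥ rk[S─C]≮rk[S]) | *-zeroʳ ∣ A0 ∣ = z≤n

    attainsΦ-whole : ∀ {S A0} → AttainsΦ M S A0 → ∣ A0 ∣ * rk M S ≤ ∣ S ∣ * (rk M S ∸ rk M (S ─ A0))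
    attainsΦ-whole {S} {A0} att =
      subst (λ t → ∣ A0 ∣ * (rk M S ∸ t) ≤ ∣ S ∣ * (rk M S ∸ rk M (S ─ A0)))
            (rk-Empty M (p─p-Empty S)) (attainsΦ-cross att id)

    -- For A0 ⊆ S, S ─ (A0 ─ A) = (S ─ A0) ∪ (A ∩ A0): this is the rank that A ∩ A0 restores to S ─ A0.
    restored-rk : Subset n → Subset n → Subset n → ℕ
    restored-rk S A0 A = rk M (S ─ (A0 ─ A)) ∸ rk M (S ─ A0)

    layer-rk-split : ∀ S A0 A → rk M S ∸ rk M (S ─ A0) ≡ (rk M S ∸ rk M (S ─ (A0 ─ A))) + restored-rk S A0 A
    layer-rk-split S A0 A =
      m∸o≡[m∸n]+[n∸o] (rk-mono M (p⊆q⇒r─q⊆r─p (p─q⊆p A0 A))) (rk-mono M (p─q⊆p S (A0 ─ A)))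

    restored-rk+rk≤rk : ∀ {S A0 A} → A ⊆ S → restored-rk S A0 A + rk M (A ─ A0) ≤ rk M A
    restored-rk+rk≤rk {S} {A0} {A} A⊆S = begin
      (rk M (S ─ (A0 ─ A)) ∸ rk M (S ─ A0)) + rk M (A ─ A0)  ≡⟨ +-∸-comm (rk M (A ─ A0)) rk[S─A0]≤rk[S─[A0─A]] ⟨
      (rk M (S ─ (A0 ─ A)) + rk M (A ─ A0)) ∸ rk M (S ─ A0)  ≤⟨ ∸-monoˡ-≤ (rk M (S ─ A0)) submodularity ⟩
      (rk M A + rk M (S ─ A0)) ∸ rk M (S ─ A0)               ≡⟨ m+n∸n≡m (rk M A) (rk M (S ─ A0)) ⟩
      rk M A                                                 ∎
      where
      open ≤-Reasoning
      rk[S─A0]≤rk[S─[A0─A]] : rk M (S ─ A0) ≤ rk M (S ─ (A0 ─ A))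
      rk[S─A0]≤rk[S─[A0─A]] = rk-mono M (p⊆q⇒r─q⊆r─p (p─q⊆p A0 A))
      S─[A0─A]⊆A∪[S─A0] : S ─ (A0 ─ A) ⊆ A ∪ (S ─ A0)
      S─[A0─A]⊆A∪[S─A0] {x} x∈ with x∈p─q⁻ S (A0 ─ A) x∈ | x ∈? A
      ... | _ , _ | yes x∈A = x∈p∪q⁺ (inj₁ x∈A)
      ... | x∈S , x∉A0─A | no x∉A =
        x∈p∪q⁺ (inj₂ (x∈p∧x∉q⇒x∈p─q x∈S (λ x∈A0 → x∉A0─A (x∈p∧x∉q⇒x∈p─q x∈A0 x∉A))))
      A─A0⊆A∩[S─A0] : A ─ A0 ⊆ A ∩ (S ─ A0)
      A─A0⊆A∩[S─A0] x∈ = x∈p∩q⁺ (p─q⊆p A A0 x∈ , p⊆q⇒p─r⊆q─r A⊆S x∈)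
      submodularity : rk M (S ─ (A0 ─ A)) + rk M (A ─ A0) ≤ rk M A + rk M (S ─ A0)
      submodularity = rk-submodular-⊆ M S─[A0─A]⊆A∪[S─A0] A─A0⊆A∩[S─A0]

    layer-part-bound : ∀ {S A0} A → AttainsΦ M S A0 →
                       ∣ A ∩ A0 ∣ * (rk M S ∸ rk M (S ─ A0)) ≤ ∣ A0 ∣ * restored-rk S A0 A
    layer-part-bound {S} {A0} A att@(A0⊆S , _) = +-cancelˡ-≤ (c * d) (b * d) (a * g) (begin
      c * d + b * d   ≡⟨ +-comm (c * d) (b * d) ⟩
      b * d + c * d   ≡⟨ *-distribʳ-+ d b c ⟨
      (b + c) * d     ≡⟨ cong (_* d) a≡b+c ⟨
      a * d           ≡⟨ cong (a *_) (layer-rk-split S A0 A) ⟩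
      a * (d′ + g)    ≡⟨ *-distribˡ-+ a d′ g ⟩
      a * d′ + a * g  ≤⟨ +-monoˡ-≤ (a * g) (attainsΦ-cross att (A0⊆S ∘ p─q⊆p A0 A)) ⟩
      c * d + a * g   ∎)
      where
      open ≤-Reasoning
      a b c d d′ g : ℕ
      a = ∣ A0 ∣
      b = ∣ A ∩ A0 ∣
      c = ∣ A0 ─ A ∣
      d = rk M S ∸ rk M (S ─ A0)
      d′ = rk M S ∸ rk M (S ─ (A0 ─ A))
      g = restored-rk S A0 A
      a≡b+c : a ≡ b + c
      a≡b+c = trans (∣p∣≡∣p∩q∣+∣p─q∣ A0 A) (cong (λ B → ∣ B ∣ + c) (∩-comm A0 A))

    layer-part-density : ∀ {S A0 D Q} A → AttainsΦ M S A0 → D * ∣ A0 ∣ ≤ (rk M S ∸ rk M (S ─ A0)) * Q →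
                         ∣ A ∩ A0 ∣ * D ≤ restored-rk S A0 A * Q
    layer-part-density {S} {A0} {D} {Q} A att D*a≤d*Q with attainsΦ-nonempty att
    ... | _ , x∈A0 = *-cancelˡ-≤ a {{>-nonZero (x∈p⇒0<∣p∣ x∈A0)}} (begin
      a * (b * D)                   ≡⟨ *-comm a (b * D) ⟩
      b * D * a                     ≡⟨ *-assoc b D a ⟩
      b * (D * a)                   ≤⟨ *-monoʳ-≤ b D*a≤d*Q ⟩
      b * (d * Q)                   ≡⟨ *-assoc b d Q ⟨
      b * d * Q                     ≤⟨ *-monoˡ-≤ Q (layer-part-bound A att) ⟩
      a * restored-rk S A0 A * Q    ≡⟨ *-assoc a _ Q ⟩
      a * (restored-rk S A0 A * Q)  ∎)
      where
      open ≤-Reasoning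
      a b d : ℕ
      a = ∣ A0 ∣
      b = ∣ A ∩ A0 ∣
      d = rk M S ∸ rk M (S ─ A0)

  module _ {n} (M : Matroid n) (ℓ : Fin n → ℚ) where

    layer-of : ∀ {S e} → IdealLoadOn M ℓ S → e ∈ S →
               ∃₂ λ S′ A0 → AttainsΦ M S′ A0 × e ∈ A0 × ℓ e ≡ frac (rk M S′ ∸ rk M (S′ ─ A0)) (∣ A0 ∣)
    layer-of (done S-empty) e∈S = ⊥-elim (S-empty (_ , e∈S))
    layer-of {e = e} (step {S} {A0} att ℓ≡d/a rest) e∈S with e ∈? A0
    ... | yes e∈A0 = S , A0 , att , e∈A0 , ℓ≡d/a e e∈A0
    ... | no e∉A0 = layer-of rest (x∈p∧x∉q⇒x∈p─q e∈S e∉A0)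

    load≥⇒density≤ : ∀ {D Q S} → 0 < Q → IdealLoadOn M ℓ S → (∀ e → e ∈ S → frac D Q ℚ.≤ ℓ e) →
                     ∀ A → A ⊆ S → ∣ A ∣ * D ≤ rk M A * Q
    load≥⇒density≤ _ (done S-empty) _ A A⊆S
      rewrite Empty⇒∣p∣≡0 (λ (x , x∈A) → S-empty (x , A⊆S x∈A)) = z≤n
    load≥⇒density≤ {D} {Q} 0<Q (step {S} {A0} att@(A0⊆S , _) ℓ≡d/a rest) D/Q≤ℓ A A⊆S = begin
      ∣ A ∣ * D                                     ≡⟨ cong (_* D) (∣p∣≡∣p∩q∣+∣p─q∣ A A0) ⟩
      (∣ A ∩ A0 ∣ + ∣ A ─ A0 ∣) * D                 ≡⟨ *-distribʳ-+ D ∣ A ∩ A0 ∣ _ ⟩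
      ∣ A ∩ A0 ∣ * D + ∣ A ─ A0 ∣ * D               ≤⟨ +-mono-≤ (layer-part-density M A att D*a≤d*Q) IH ⟩
      restored-rk M S A0 A * Q + rk M (A ─ A0) * Q  ≡⟨ *-distribʳ-+ Q (restored-rk M S A0 A) _ ⟨
      (restored-rk M S A0 A + rk M (A ─ A0)) * Q    ≤⟨ *-monoˡ-≤ Q (restored-rk+rk≤rk M A⊆S) ⟩
      rk M A * Q                                    ∎
      where
      open ≤-Reasoning
      IH : ∣ A ─ A0 ∣ * D ≤ rk M (A ─ A0) * Q
      IH = load≥⇒density≤ 0<Q rest (λ e → D/Q≤ℓ e ∘ p─q⊆p S A0) (A ─ A0) (p⊆q⇒p─r⊆q─r A⊆S)
      D*a≤d*Q : D * ∣ A0 ∣ ≤ (rk M S ∸ rk M (S ─ A0)) * Q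
      D*a≤d*Q with attainsΦ-nonempty M att
      ... | x , x∈A0 = frac-≤-cross⁻ 0<Q (x∈p⇒0<∣p∣ x∈A0)
                         (subst (frac D Q ℚ.≤_) (ℓ≡d/a x x∈A0) (D/Q≤ℓ x (A0⊆S x∈A0)))

    minimum-load : IsIdealLoad M ℓ → ∀ e₀ → (∀ e → ℓ e₀ ℚ.≤ ℓ e) →
                   ∃ λ A₀ → Nonempty A₀ × (∀ A → frac (∣ A ∣) (rk M A) ℚ.≤ frac (∣ A₀ ∣) (rk M A₀)) ×
                            ℓ e₀ ≡ frac (rk M A₀) (∣ A₀ ∣)
    minimum-load ideal e₀ e₀-minimal with layer-of ideal ∈⊤
    ... | S , A0 , att@(A0⊆S , rk[S─A0]<rk[S] , _) , e₀∈A0 , ℓe₀≡d/a =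
      S , (e₀ , e₀∈S) , densest , trans ℓe₀≡d/a (frac-≡-cross 0<a (x∈p⇒0<∣p∣ e₀∈S) d*∣S∣≡rk[S]*a)
      where
      a d : ℕ
      a = ∣ A0 ∣
      d = rk M S ∸ rk M (S ─ A0)
      e₀∈S : e₀ ∈ S
      e₀∈S = A0⊆S e₀∈A0
      0<a : 0 < a
      0<a = x∈p⇒0<∣p∣ e₀∈A0
      0<d : 0 < d
      0<d = m<n⇒0<n∸m rk[S─A0]<rk[S]
      density≤a/d : ∀ A → ∣ A ∣ * d ≤ a * rk M A
      density≤a/d A = subst (∣ A ∣ * d ≤_) (*-comm (rk M A) a)
        (load≥⇒density≤ 0<a ideal (λ e _ → subst (ℚ._≤ ℓ e) ℓe₀≡d/a (e₀-minimal e)) A (λ _ → ∈⊤))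
      ∣S∣*d≡a*rk[S] : ∣ S ∣ * d ≡ a * rk M S
      ∣S∣*d≡a*rk[S] = ≤-antisym (density≤a/d S) (attainsΦ-whole M att)
      d*∣S∣≡rk[S]*a : d * ∣ S ∣ ≡ rk M S * a
      d*∣S∣≡rk[S]*a = trans (*-comm d ∣ S ∣) (trans ∣S∣*d≡a*rk[S] (*-comm a (rk M S)))
      densest : ∀ A → frac (∣ A ∣) (rk M A) ℚ.≤ frac (∣ S ∣) (rk M S)
      densest A = begin
        frac (∣ A ∣) (rk M A)  ≤⟨ frac-≤-cross⁺ 0<d (density≤a/d A) ⟩
        frac a d               ≡⟨ frac-≡-cross 0<d (≤-<-trans z≤n rk[S─A0]<rk[S]) (sym ∣S∣*d≡a*rk[S]) ⟩
        frac (∣ S ∣) (rk M S)  ∎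
        where open ℚ.≤-Reasoning

open import Defs
open import Data.Nat using (ℕ; _<_)
open import Data.Fin using (Fin)
open import Data.Fin.Subset using (Subset; ∣_∣; Nonempty)
open import Data.Product using (∃; _×_; _,_)
open import Data.Rational using (ℚ; _≤_)
open import Data.Rational.Properties using (≤-decTotalOrder)
open import Relation.Binary.Bundles using (DecTotalOrder)
open import Relation.Binary.PropositionalEquality using (_≡_)
open IdealLoadProperties using (minimiser; minimum-load)

theorem1p8 : ∀ (n : ℕ) (M : Matroid n) → 0 < n → Loopless M →
    ∀ (ℓ : Fin n → ℚ) → IsIdealLoad M ℓ →
    ∃ λ (e₀ : Fin n) → (∀ e → ℓ e₀ ≤ ℓ e) ×
    ∃ λ (A₀ : Subset n) → Nonempty A₀ ×
      (∀ (A : Subset n) → Nonempty A → frac (∣ A ∣) (rk M A) ≤ frac (∣ A₀ ∣) (rk M A₀)) ×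
      ℓ e₀ ≡ frac (rk M A₀) (∣ A₀ ∣)
theorem1p8 n M 0<n _ ℓ ideal with minimiser (DecTotalOrder.totalOrder ≤-decTotalOrder) 0<n ℓ
... | e₀ , e₀-minimal with minimum-load M ℓ ideal e₀ e₀-minimal
...   | A₀ , A₀-nonempty , A₀-densest , ℓe₀≡ =
  e₀ , e₀-minimal , A₀ , A₀-nonempty , (λ A _ → A₀-densest A) , ℓe₀≡
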